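{- For every constant $\alpha > 0$ there is a constant $a_0>0$ such that for every $0 < a \le a_0$ the following holds. Let $k$ be such that $R = a\sqrt{n}/k$ is an integer dividing $\sqrt{n}$, and let $\sqrt{m} = \sqrt{n}/R = k/a$. Suppose $\widehat{x}$ is drawn from the Bernoulli model with parameter $k$, and map each position $(i,j) \in [\sqrt{n}]^2$ to the position $(i \bmod \sqrt{m},\, j \bmod \sqrt{m}) \in [\sqrt{m}]^2$. Then with probability at least $1-\alpha$ no two distinct positions in the support of $\widehat{x}$ are mapped to the same position, i.e., the mapping restricted to $\mathrm{supp}(\widehat{x})$ is one-to-one.
   Context: Let $n$ be such that $\sqrt{n}$ is a power of $2$, and write $[m] = \{0,\dots,m-1\}$. Bernoulli model with parameter $k$ on $\widehat{x} \in \mathbb{C}^{\sqrt{n}\times\sqrt{n}}$: there is a fixed (unknown, arbitrary) matrix of values $(a_{i,j})$; independently for each $(i,j) \in [\sqrt{n}]^2$, with probability $k/n$ the entry $\widehat{x}_{i,j}$ equals $a_{i,j}$, and otherwise $\widehat{x}_{i,j}=0$. (This mapping describes how the spectrum folds when $x$ is subsampled as $x'_{i,j} = x_{iR,jR}$.)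
   Formalization: The constant α ranges over the positive rationals. -}

module Defs where

open import Data.Nat using (ℕ; zero; suc; _^_)
open import Data.Nat.DivMod using (_%_)
open import Data.Bool using (Bool; true; false; if_then_else_; _∧_)
open import Data.Fin using (Fin; toℕ; combine)
open import Data.Fin.Properties using (all?)
open import Data.Vec.Functional using (_∷_)
open import Data.Integer using (+_)
open import Data.Rational using (ℚ; 0ℚ; 1ℚ; _+_; _*_; _-_; _/_)
open import Data.Product using (_×_; _,_)
open import Relation.Nullary using (Dec; does; ¬_)
open import Relation.Nullary.Decidable using (_→-dec_; _×-dec_; ¬?)
open import Relation.Binary.PropositionalEquality using (_≡_)
import Data.Nat as ℕ
import Data.Fin as F

-- Probability that a Boolean event E holds when the d coordinates of
-- b : Fin d → Bool are independent Bernoulli(p) variables (true w.p. p):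
-- Σ_b [E b] Π_i (p if b i else 1-p), computed by recursion on d.
Pr : (p : ℚ) (d : ℕ) → ((Fin d → Bool) → Bool) → ℚ
Pr p zero    E = if E (λ ()) then 1ℚ else 0ℚ
Pr p (suc d) E = (p * Pr p d (λ b → E (true ∷ b)))
               + ((1ℚ - p) * Pr p d (λ b → E (false ∷ b)))

-- k / n as a rational (n = 0 does not occur in the statement).
ratio : ℕ → ℕ → ℚ
ratio k zero    = 0ℚ
ratio k (suc n) = (+ k) / suc n

-- i mod s (s = 0 does not occur in the statement; it is s = √m ≥ 1).
_mod_ : ℕ → ℕ → ℕ
i mod zero  = i
i mod suc s = i % suc s

-- A sample of the Bernoulli model on [N]×[N] is b : Fin (N*N) → Bool,
-- position (i,j) lies in the support iff b (combine i j) = true.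
supp : (N : ℕ) → (Fin (N ℕ.* N) → Bool) → Fin N → Fin N → Bool
supp N b i j = b (combine i j)

InjOnSupp : (N s : ℕ) → (Fin (N ℕ.* N) → Bool) → Set
InjOnSupp N s b =
  ∀ (i j i' j' : Fin N) → supp N b i j ≡ true → supp N b i' j' ≡ true →
    ¬ ((i , j) ≡ (i' , j')) →
    ¬ ((toℕ i mod s ≡ toℕ i' mod s) × (toℕ j mod s ≡ toℕ j' mod s))

injOnSupp? : (N s : ℕ) (b : Fin (N ℕ.* N) → Bool) → Dec (InjOnSupp N s b)
injOnSupp? N s b =
  all? λ i → all? λ j → all? λ i' → all? λ j' →
    (supp N b i j Data.Bool.≟ true) →-dec
    ((supp N b i' j' Data.Bool.≟ true) →-dec
    (¬? (pairEq i j i' j') →-dec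
    ¬? ((toℕ i mod s ℕ.≟ toℕ i' mod s) ×-dec (toℕ j mod s ℕ.≟ toℕ j' mod s))))
  where
  open import Data.Product.Properties using (≡-dec)
  pairEq : (i j i' j' : Fin N) → Dec ((i , j) ≡ (i' , j'))
  pairEq i j i' j' = ≡-dec F._≟_ F._≟_ (i , j) (i' , j')

module Submission where

open import Defs
open import Data.Nat using (ℕ; _^_)
open import Data.Integer using (+_)
open import Data.Rational using (ℚ; 0ℚ; 1ℚ; _<_; _≤_; _*_; _-_; _/_)
open import Data.Product using (Σ; _×_)
open import Relation.Binary.PropositionalEquality using (_≡_)
open import Relation.Nullary using (does)
import Data.Nat as ℕ

open import Algebra.Bundles using (Ring)
open import Data.Bool using (Bool; true; false; if_then_else_; _∧_)
open import Data.Bool.Properties using (∧-comm)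
open import Data.Empty using (⊥-elim)
open import Data.Fin using (Fin; zero; suc; toℕ; combine; _↑ˡ_; _↑ʳ_)
import Data.Fin.Properties as FP
import Data.Integer as ℤ
import Data.Integer.Properties as ℤP
open import Data.Nat using (NonZero; zero; suc)
open import Data.Nat.DivMod using (_%_; [m+n]%n≡m%n; m<n⇒m%n≡m)
import Data.Nat.Properties as ℕP
open import Data.Product using (_,_; proj₂)
open import Data.Product.Properties using (≡-dec)
open import Data.Rational using (_+_; -_; _⊓_; toℚᵘ; Positive; nonNegative)
open import Data.Rational.Properties
open import Data.Rational.Solver using (module +-*-Solver)
open import Data.Rational.Unnormalised using (mkℚᵘ; *≡*)
import Data.Rational.Unnormalised as ℚᵘ
import Data.Rational.Unnormalised.Properties as ℚᵘP
open import Data.Sum using (inj₁; inj₂)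
open import Data.Vec.Functional using (_∷_)
open import Function using (_∘_)
open import Relation.Binary.PropositionalEquality using (refl; sym; trans; cong; cong₂; subst; module ≡-Reasoning)
open import Relation.Nullary using (¬_; Dec; yes; no)
open import Relation.Nullary.Decidable using (_×-dec_; ¬?; dec-true)
open import Algebra.Properties.Semiring.Sum (Ring.semiring +-*-ring)
  using (sum; sum-syntax; sum-replicate-zero; *-distribˡ-sum; *-distribʳ-sum)

-- Write N = √n = 2^t, p = k/N² and call two distinct
-- positions (i,j), (i',j') of [N]² colliding when i ≡ i' and j ≡ j' (mod s),
-- s = √m.  The argument is a union bound over colliding pairs:
--   * pointwise, 1[fold injective on the support] + #(colliding pairs inside
--     the support) ≥ 1, since a non-injective fold exhibits such a pair;
--   * under the product Bernoulli(p) measure each colliding pair lies in the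
--     support with probability p² (two distinct coordinates), and there are at
--     most (N·R)² colliding pairs, as every residue class mod s in [R·s] has R
--     elements;
--   * hence Pr[injective] ≥ 1 - (N·R·p)², and N·R·p = R·k/N = a.
-- With a₀ = min(α, 1) the failure probability is a² ≤ a ≤ α.

fromℕ : ℕ → ℚ
fromℕ n = (+ n) / 1

fromℕ-+ : ∀ m n → fromℕ (m ℕ.+ n) ≡ fromℕ m + fromℕ n
fromℕ-+ m n = toℚᵘ-injective (begin
    toℚᵘ (fromℕ (m ℕ.+ n))               ≈⟨ toℚᵘ-fromℚᵘ (mkℚᵘ (+ (m ℕ.+ n)) 0) ⟩
    mkℚᵘ (+ (m ℕ.+ n)) 0                 ≈⟨ *≡* numerators ⟩
    mkℚᵘ (+ m) 0 ℚᵘ.+ mkℚᵘ (+ n) 0       ≈⟨ ℚᵘP.+-cong (toℚᵘ-fromℚᵘ (mkℚᵘ (+ m) 0)) (toℚᵘ-fromℚᵘ (mkℚᵘ (+ n) 0)) ⟨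
    toℚᵘ (fromℕ m) ℚᵘ.+ toℚᵘ (fromℕ n)   ≈⟨ toℚᵘ-homo-+ (fromℕ m) (fromℕ n) ⟨
    toℚᵘ (fromℕ m + fromℕ n)             ∎)
  where
  open ℚᵘP.≃-Reasoning
  numerators : + (m ℕ.+ n) ℤ.* + 1 ≡ (+ m ℤ.* + 1 ℤ.+ + n ℤ.* + 1) ℤ.* + 1
  numerators rewrite ℤP.*-identityʳ (+ m) | ℤP.*-identityʳ (+ n) = cong (ℤ._* + 1) (ℤP.pos-+ m n)

fromℕ-suc : ∀ n → fromℕ (suc n) ≡ 1ℚ + fromℕ n
fromℕ-suc = fromℕ-+ 1

fromℕ-* : ∀ m n → fromℕ (m ℕ.* n) ≡ fromℕ m * fromℕ n
fromℕ-* zero    n = sym (*-zeroˡ (fromℕ n))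
fromℕ-* (suc m) n = begin
    fromℕ (n ℕ.+ m ℕ.* n)            ≡⟨ fromℕ-+ n (m ℕ.* n) ⟩
    fromℕ n + fromℕ (m ℕ.* n)        ≡⟨ cong₂ _+_ (sym (*-identityˡ (fromℕ n))) (fromℕ-* m n) ⟩
    1ℚ * fromℕ n + fromℕ m * fromℕ n ≡⟨ *-distribʳ-+ (fromℕ n) 1ℚ (fromℕ m) ⟨
    (1ℚ + fromℕ m) * fromℕ n         ≡⟨ cong (_* fromℕ n) (fromℕ-suc m) ⟨
    fromℕ (suc m) * fromℕ n          ∎
  where open ≡-Reasoning

fromℕ-nonNeg : ∀ n → 0ℚ ≤ fromℕ n
fromℕ-nonNeg n = nonNegative⁻¹ (fromℕ n) {{normalize-nonNeg n 1}}

fromℕ-pos : ∀ n .{{_ : NonZero n}} → Positive (fromℕ n)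
fromℕ-pos n = normalize-pos n 1

1≤fromℕ : ∀ n .{{_ : NonZero n}} → 1ℚ ≤ fromℕ n
1≤fromℕ (suc n) = begin
    1ℚ            ≡⟨ +-identityʳ 1ℚ ⟨
    1ℚ + 0ℚ       ≤⟨ +-monoʳ-≤ 1ℚ (fromℕ-nonNeg n) ⟩
    1ℚ + fromℕ n  ≡⟨ fromℕ-suc n ⟨
    fromℕ (suc n) ∎
  where open ≤-Reasoning

ratio-nonNeg : ∀ k n → 0ℚ ≤ ratio k n
ratio-nonNeg k zero    = ≤-refl
ratio-nonNeg k (suc n) = nonNegative⁻¹ (ratio k (suc n)) {{normalize-nonNeg k (suc n)}}

ratio-*-fromℕ : ∀ k n .{{_ : NonZero n}} → ratio k n * fromℕ n ≡ fromℕ k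
ratio-*-fromℕ k (suc n) = toℚᵘ-injective (begin
    toℚᵘ (ratio k (suc n) * fromℕ (suc n))           ≈⟨ toℚᵘ-homo-* (ratio k (suc n)) (fromℕ (suc n)) ⟩
    toℚᵘ (ratio k (suc n)) ℚᵘ.* toℚᵘ (fromℕ (suc n)) ≈⟨ ℚᵘP.*-cong (toℚᵘ-fromℚᵘ (mkℚᵘ (+ k) n))
                                                                    (toℚᵘ-fromℚᵘ (mkℚᵘ (+ suc n) 0)) ⟩
    mkℚᵘ (+ k) n ℚᵘ.* mkℚᵘ (+ suc n) 0               ≈⟨ *≡* cross ⟩
    mkℚᵘ (+ k) 0                                     ≈⟨ toℚᵘ-fromℚᵘ (mkℚᵘ (+ k) 0) ⟨
    toℚᵘ (fromℕ k)                                   ∎)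
  where
  open ℚᵘP.≃-Reasoning
  cross : (+ k ℤ.* + suc n) ℤ.* + 1 ≡ + k ℤ.* + (suc n ℕ.* 1)
  cross = trans (ℤP.*-identityʳ _) (cong (λ d → + k ℤ.* + d) (sym (ℕP.*-identityʳ (suc n))))

nonNeg-* : ∀ {x y} → 0ℚ ≤ x → 0ℚ ≤ y → 0ℚ ≤ x * y
nonNeg-* {x} {y} 0≤x 0≤y =
  nonNegative⁻¹ (x * y) {{nonNeg*nonNeg⇒nonNeg x {{nonNegative 0≤x}} y {{nonNegative 0≤y}}}}

*-mono-≤-nonNeg : ∀ {x y u v} → 0ℚ ≤ x → 0ℚ ≤ v → x ≤ y → u ≤ v → x * u ≤ y * v
*-mono-≤-nonNeg {x} {y} {u} {v} 0≤x 0≤v x≤y u≤v =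
  ≤-trans (*-monoˡ-≤-nonNeg x {{nonNegative 0≤x}} u≤v) (*-monoʳ-≤-nonNeg v {{nonNegative 0≤v}} x≤y)

1≤x+y⇒1-y≤x : ∀ x y → 1ℚ ≤ x + y → 1ℚ - y ≤ x
1≤x+y⇒1-y≤x x y 1≤x+y = ≤-trans (+-monoˡ-≤ (- y) 1≤x+y) (≤-reflexive (x+y-y≡x x y))
  where
  open +-*-Solver
  x+y-y≡x : ∀ x y → x + y - y ≡ x
  x+y-y≡x = solve 2 (λ x y → x :+ y :- y := x) refl

ind : Bool → ℚ
ind c = if c then 1ℚ else 0ℚ

ind-nonNeg : ∀ c → 0ℚ ≤ ind c
ind-nonNeg true  = nonNegative⁻¹ 1ℚ
ind-nonNeg false = ≤-refl

sum-cong : ∀ {n} {f g : Fin n → ℚ} → (∀ i → f i ≡ g i) → sum f ≡ sum g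
sum-cong {zero}  f≡g = refl
sum-cong {suc n} f≡g = cong₂ _+_ (f≡g zero) (sum-cong (f≡g ∘ suc))

sum-mono : ∀ {n} {f g : Fin n → ℚ} → (∀ i → f i ≤ g i) → sum f ≤ sum g
sum-mono {zero}  f≤g = ≤-refl
sum-mono {suc n} f≤g = +-mono-≤ (f≤g zero) (sum-mono (f≤g ∘ suc))

sum-nonNeg : ∀ {n} (f : Fin n → ℚ) → (∀ i → 0ℚ ≤ f i) → 0ℚ ≤ sum f
sum-nonNeg {n} f f≥0 = ≤-trans (≤-reflexive (sym (sum-replicate-zero n))) (sum-mono f≥0)

term≤sum : ∀ {n} (f : Fin n → ℚ) → (∀ i → 0ℚ ≤ f i) → ∀ i → f i ≤ sum f
term≤sum {suc n} f f≥0 zero = begin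
    f zero                          ≡⟨ +-identityʳ (f zero) ⟨
    f zero + 0ℚ                     ≤⟨ +-monoʳ-≤ (f zero) (sum-nonNeg (f ∘ suc) (f≥0 ∘ suc)) ⟩
    f zero + ∑[ i < n ] f (suc i)   ∎
  where open ≤-Reasoning
term≤sum {suc n} f f≥0 (suc i) = begin
    f (suc i)                       ≤⟨ term≤sum (f ∘ suc) (f≥0 ∘ suc) i ⟩
    ∑[ j < n ] f (suc j)            ≡⟨ +-identityˡ _ ⟨
    0ℚ + ∑[ j < n ] f (suc j)       ≤⟨ +-monoˡ-≤ _ (f≥0 zero) ⟩
    f zero + ∑[ j < n ] f (suc j)   ∎
  where open ≤-Reasoning

sum-const : ∀ n v → ∑[ i < n ] v ≡ fromℕ n * v
sum-const zero    v = sym (*-zeroˡ v)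
sum-const (suc n) v = begin
    v + ∑[ i < n ] v      ≡⟨ cong₂ _+_ (sym (*-identityˡ v)) (sum-const n v) ⟩
    1ℚ * v + fromℕ n * v  ≡⟨ *-distribʳ-+ v 1ℚ (fromℕ n) ⟨
    (1ℚ + fromℕ n) * v    ≡⟨ cong (_* v) (fromℕ-suc n) ⟨
    fromℕ (suc n) * v     ∎
  where open ≡-Reasoning

sum-++ : ∀ m {n} (f : Fin (m ℕ.+ n) → ℚ) →
         sum f ≡ ∑[ i < m ] f (i ↑ˡ n) + ∑[ j < n ] f (m ↑ʳ j)
sum-++ zero    f = sym (+-identityˡ (sum f))
sum-++ (suc m) f = trans (cong (_+_ (f zero)) (sum-++ m (f ∘ suc))) (sym (+-assoc (f zero) _ _))

∑∑-*ʳ : ∀ {m n} (h : Fin m → Fin n → ℚ) c →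
        ∑[ i < m ] ∑[ j < n ] (h i j * c) ≡ (∑[ i < m ] ∑[ j < n ] h i j) * c
∑∑-*ʳ {m} {n} h c =
  sym (trans (*-distribʳ-sum c (λ i → ∑[ j < n ] h i j)) (sum-cong {m} λ i → *-distribʳ-sum c (h i)))

∑∑-*ˡ : ∀ {m n} (h : Fin m → Fin n → ℚ) c →
        ∑[ i < m ] ∑[ j < n ] (c * h i j) ≡ c * ∑[ i < m ] ∑[ j < n ] h i j
∑∑-*ˡ {m} {n} h c =
  sym (trans (*-distribˡ-sum c (λ i → ∑[ j < n ] h i j)) (sum-cong {m} λ i → *-distribˡ-sum c (h i)))

∑⁴-factor : ∀ {n} (f g : Fin n → Fin n → ℚ) q →
  ∑[ i < n ] ∑[ i' < n ] ∑[ j < n ] ∑[ j' < n ] ((f i i' * g j j') * q)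
    ≡ (∑[ i < n ] ∑[ i' < n ] f i i') * ((∑[ j < n ] ∑[ j' < n ] g j j') * q)
∑⁴-factor {n} f g q = begin
    ∑[ i < n ] ∑[ i' < n ] ∑[ j < n ] ∑[ j' < n ] ((f i i' * g j j') * q)
      ≡⟨ sum-cong {n} (λ i → sum-cong {n} λ i' → trans
           (sum-cong {n} λ j → sum-cong {n} λ j' → *-assoc (f i i') (g j j') q)
           (∑∑-*ˡ (λ j j' → g j j' * q) (f i i'))) ⟩
    ∑[ i < n ] ∑[ i' < n ] (f i i' * ∑[ j < n ] ∑[ j' < n ] (g j j' * q))
      ≡⟨ ∑∑-*ʳ f _ ⟩
    (∑[ i < n ] ∑[ i' < n ] f i i') * ∑[ j < n ] ∑[ j' < n ] (g j j' * q)
      ≡⟨ cong (_*_ (∑[ i < n ] ∑[ i' < n ] f i i')) (∑∑-*ʳ g q) ⟩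
    (∑[ i < n ] ∑[ i' < n ] f i i') * ((∑[ j < n ] ∑[ j' < n ] g j j') * q) ∎
  where open ≡-Reasoning

at-most-one : ∀ n c → ∑[ x < n ] ind (does (c ℕ.≟ toℕ x)) ≤ 1ℚ
at-most-one zero    c       = ind-nonNeg true
at-most-one (suc n) zero    = ≤-reflexive (trans (cong (_+_ 1ℚ) (sum-replicate-zero n)) (+-identityʳ 1ℚ))
at-most-one (suc n) (suc c) = ≤-trans (≤-reflexive (+-identityˡ _)) (at-most-one n c)

residue-count : ∀ R s .{{_ : NonZero s}} c →
                ∑[ x < R ℕ.* s ] ind (does (c ℕ.≟ toℕ x % s)) ≤ fromℕ R
residue-count zero    s c = ≤-refl
residue-count (suc R) s c = begin
    ∑[ x < s ℕ.+ R ℕ.* s ] g (toℕ x)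
      ≡⟨ sum-++ s (g ∘ toℕ) ⟩
    ∑[ x < s ] g (toℕ (x ↑ˡ R ℕ.* s)) + ∑[ y < R ℕ.* s ] g (toℕ (s ↑ʳ y))
      ≡⟨ cong₂ _+_ (sum-cong {s} first-block) (sum-cong {R ℕ.* s} later-blocks) ⟩
    ∑[ x < s ] ind (does (c ℕ.≟ toℕ x)) + ∑[ y < R ℕ.* s ] g (toℕ y)
      ≤⟨ +-mono-≤ (at-most-one s c) (residue-count R s c) ⟩
    1ℚ + fromℕ R
      ≡⟨ fromℕ-suc R ⟨
    fromℕ (suc R) ∎
  where
  open ≤-Reasoning
  g : ℕ → ℚ
  g x = ind (does (c ℕ.≟ x % s))
  -- the first block [0, s) is reduced modulo s already
  first-block : ∀ x → g (toℕ (x ↑ˡ R ℕ.* s)) ≡ ind (does (c ℕ.≟ toℕ x))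
  first-block x = cong (λ y → ind (does (c ℕ.≟ y)))
    (trans (cong (_% s) (FP.toℕ-↑ˡ x (R ℕ.* s))) (m<n⇒m%n≡m (FP.toℕ<n x)))
  -- shifting by s does not change the residue
  later-blocks : ∀ y → g (toℕ (s ↑ʳ y)) ≡ g (toℕ y)
  later-blocks y = cong (λ z → ind (does (c ℕ.≟ z)))
    (trans (cong (_% s) (trans (FP.toℕ-↑ʳ s y) (ℕP.+-comm s (toℕ y)))) ([m+n]%n≡m%n (toℕ y) s))

congruent : (s : ℕ) {N : ℕ} → Fin N → Fin N → Bool
congruent s i i' = does (toℕ i mod s ℕ.≟ toℕ i' mod s)

congruent-pairs : ∀ {N} R s .{{_ : NonZero s}} → R ℕ.* s ≡ N →
                  ∑[ i < N ] ∑[ i' < N ] ind (congruent s i i') ≤ fromℕ N * fromℕ R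
congruent-pairs {N} R s@(suc _) R*s≡N = begin
    ∑[ i < N ] ∑[ i' < N ] ind (congruent s i i') ≤⟨ sum-mono {N} (λ i → class-size (toℕ i % s)) ⟩
    ∑[ i < N ] fromℕ R                            ≡⟨ sum-const N (fromℕ R) ⟩
    fromℕ N * fromℕ R                             ∎
  where
  open ≤-Reasoning
  class-size : ∀ c → ∑[ i' < N ] ind (does (c ℕ.≟ toℕ i' % s)) ≤ fromℕ R
  class-size c = subst (λ n → ∑[ i' < n ] ind (does (c ℕ.≟ toℕ i' % s)) ≤ fromℕ R) R*s≡N
                       (residue-count R s c)

-- The Bernoulli(p) expectation on {true,false}^d: condition on the first
-- coordinate, which is true with probability p.  `Pr` of Defs is its
-- specialisation to indicators.
mix : ℚ → ℚ → ℚ → ℚ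
mix p x y = p * x + (1ℚ - p) * y

mix-+ : ∀ p x y u v → mix p (x + y) (u + v) ≡ mix p x u + mix p y v
mix-+ = solve 5 (λ p x y u v → p :* (x :+ y) :+ (con 1ℚ :- p) :* (u :+ v)
                            := (p :* x :+ (con 1ℚ :- p) :* u) :+ (p :* y :+ (con 1ℚ :- p) :* v)) refl
  where open +-*-Solver

mix-idem : ∀ p x → mix p x x ≡ x
mix-idem = solve 2 (λ p x → p :* x :+ (con 1ℚ :- p) :* x := x) refl
  where open +-*-Solver

mix-zeroʳ : ∀ p x → mix p x 0ℚ ≡ p * x
mix-zeroʳ = solve 2 (λ p x → p :* x :+ (con 1ℚ :- p) :* con 0ℚ := p :* x) refl
  where open +-*-Solver

mix-mono : ∀ {p} → 0ℚ ≤ p → p ≤ 1ℚ → ∀ {x y u v} → x ≤ y → u ≤ v → mix p x u ≤ mix p y v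
mix-mono {p} 0≤p p≤1 x≤y u≤v =
  +-mono-≤ (*-monoˡ-≤-nonNeg p {{nonNegative 0≤p}} x≤y)
           (*-monoˡ-≤-nonNeg (1ℚ - p) {{nonNegative 0≤1-p}} u≤v)
  where
  0≤1-p : 0ℚ ≤ 1ℚ - p
  0≤1-p = ≤-trans (≤-reflexive (sym (+-inverseʳ p))) (+-monoˡ-≤ (- p) p≤1)

Expect : ℚ → (d : ℕ) → ((Fin d → Bool) → ℚ) → ℚ
Expect p zero    f = f (λ ())
Expect p (suc d) f = mix p (Expect p d (λ b → f (true ∷ b))) (Expect p d (λ b → f (false ∷ b)))

Pr≡Expect : ∀ p d E → Pr p d E ≡ Expect p d (ind ∘ E)
Pr≡Expect p zero    E = refl
Pr≡Expect p (suc d) E = cong₂ (mix p) (Pr≡Expect p d _) (Pr≡Expect p d _)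

Expect-cong : ∀ p d {f g : (Fin d → Bool) → ℚ} → (∀ b → f b ≡ g b) → Expect p d f ≡ Expect p d g
Expect-cong p zero    f≡g = f≡g _
Expect-cong p (suc d) f≡g =
  cong₂ (mix p) (Expect-cong p d (f≡g ∘ (true ∷_))) (Expect-cong p d (f≡g ∘ (false ∷_)))

Expect-const : ∀ p d v → Expect p d (λ _ → v) ≡ v
Expect-const p zero    v = refl
Expect-const p (suc d) v = trans (cong₂ (mix p) (Expect-const p d v) (Expect-const p d v)) (mix-idem p v)

Expect-+ : ∀ p d (f g : (Fin d → Bool) → ℚ) →
           Expect p d (λ b → f b + g b) ≡ Expect p d f + Expect p d g
Expect-+ p zero    f g = refl
Expect-+ p (suc d) f g = trans (cong₂ (mix p) (Expect-+ p d _ _) (Expect-+ p d _ _)) (mix-+ p _ _ _ _)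

Expect-sum : ∀ p d n (f : Fin n → (Fin d → Bool) → ℚ) →
             Expect p d (λ b → ∑[ i < n ] f i b) ≡ ∑[ i < n ] Expect p d (f i)
Expect-sum p d zero    f = Expect-const p d 0ℚ
Expect-sum p d (suc n) f =
  trans (Expect-+ p d _ _) (cong (_+_ (Expect p d (f zero))) (Expect-sum p d n (f ∘ suc)))

Expect-sum² : ∀ p d {m n} (f : Fin m → Fin n → (Fin d → Bool) → ℚ) →
              Expect p d (λ b → ∑[ i < m ] ∑[ j < n ] f i j b) ≡ ∑[ i < m ] ∑[ j < n ] Expect p d (f i j)
Expect-sum² p d {m} {n} f =
  trans (Expect-sum p d m (λ i b → ∑[ j < n ] f i j b)) (sum-cong {m} λ i → Expect-sum p d n (f i))

Expect-mono : ∀ {p} → 0ℚ ≤ p → p ≤ 1ℚ → ∀ d {f g : (Fin d → Bool) → ℚ} →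
              (∀ b → f b ≤ g b) → Expect p d f ≤ Expect p d g
Expect-mono 0≤p p≤1 zero    f≤g = f≤g _
Expect-mono 0≤p p≤1 (suc d) f≤g =
  mix-mono 0≤p p≤1 (Expect-mono 0≤p p≤1 d (f≤g ∘ (true ∷_))) (Expect-mono 0≤p p≤1 d (f≤g ∘ (false ∷_)))

Expect-coord : ∀ p d (x : Fin d) → Expect p d (λ b → ind (b x)) ≡ p
Expect-coord p (suc d) zero    =
  trans (cong₂ (mix p) (Expect-const p d 1ℚ) (Expect-const p d 0ℚ)) (trans (mix-zeroʳ p 1ℚ) (*-identityʳ p))
Expect-coord p (suc d) (suc x) =
  trans (cong₂ (mix p) (Expect-coord p d x) (Expect-coord p d x)) (mix-idem p p)

Expect-pair : ∀ p d (x y : Fin d) → ¬ x ≡ y → Expect p d (λ b → ind (b x ∧ b y)) ≡ p * p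
Expect-pair p (suc d) zero    zero    x≢y = ⊥-elim (x≢y refl)
Expect-pair p (suc d) zero    (suc y) x≢y =
  trans (cong₂ (mix p) (Expect-coord p d y) (Expect-const p d 0ℚ)) (mix-zeroʳ p p)
Expect-pair p (suc d) (suc x) zero    x≢y =
  trans (Expect-cong p (suc d) (λ b → cong ind (∧-comm (b (suc x)) (b zero))))
        (Expect-pair p (suc d) zero (suc x) (x≢y ∘ sym))
Expect-pair p (suc d) (suc x) (suc y) x≢y =
  trans (cong₂ (mix p) (Expect-pair p d x y (x≢y ∘ cong suc)) (Expect-pair p d x y (x≢y ∘ cong suc)))
        (mix-idem p (p * p))

Expect-guard : ∀ p d {A : Set} (a? : Dec A) (X : (Fin d → Bool) → Bool) {v} →
               (A → Expect p d (ind ∘ X) ≡ v) → Expect p d (λ b → ind (does a? ∧ X b)) ≡ ind (does a?) * v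
Expect-guard p d (yes a) X {v} E≡v = trans (E≡v a) (sym (*-identityˡ v))
Expect-guard p d (no _)  X {v} E≡v = trans (Expect-const p d 0ℚ) (sym (*-zeroˡ v))

Collide : (N s : ℕ) (i j i' j' : Fin N) → Set
Collide N s i j i' j' =
  ¬ (i , j) ≡ (i' , j') × toℕ i mod s ≡ toℕ i' mod s × toℕ j mod s ≡ toℕ j' mod s

collide? : (N s : ℕ) (i j i' j' : Fin N) → Dec (Collide N s i j i' j')
collide? N s i j i' j' =
  ¬? (≡-dec FP._≟_ FP._≟_ (i , j) (i' , j'))
  ×-dec (toℕ i mod s ℕ.≟ toℕ i' mod s) ×-dec (toℕ j mod s ℕ.≟ toℕ j' mod s)

collision : (N s : ℕ) → (Fin (N ℕ.* N) → Bool) → (i i' j j' : Fin N) → ℚ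
collision N s b i i' j j' = ind (does (collide? N s i j i' j') ∧ (supp N b i j ∧ supp N b i' j'))

collisions : (N s : ℕ) → (Fin (N ℕ.* N) → Bool) → ℚ
collisions N s b = ∑[ i < N ] ∑[ i' < N ] ∑[ j < N ] ∑[ j' < N ] collision N s b i i' j j'

collisions-nonNeg : ∀ N s b → 0ℚ ≤ collisions N s b
collisions-nonNeg N s b =
  sum-nonNeg _ λ i → sum-nonNeg _ λ i' → sum-nonNeg _ λ j →
  sum-nonNeg (collision N s b i i' j) λ _ → ind-nonNeg _

collision≤collisions : ∀ N s b i i' j j' → collision N s b i i' j j' ≤ collisions N s b
collision≤collisions N s b i i' j j' =
  ≤-trans (term≤sum (T i i' j) (λ _ → ind-nonNeg _) j')
  (≤-trans (term≤sum (λ j → sum (T i i' j)) (nonNeg₁ i i') j)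
  (≤-trans (term≤sum (λ i' → ∑[ j < N ] sum (T i i' j)) (nonNeg₂ i) i')
           (term≤sum (λ i → ∑[ i' < N ] ∑[ j < N ] sum (T i i' j)) nonNeg₃ i)))
  where
  T = collision N s b
  nonNeg₁ : ∀ i i' j → 0ℚ ≤ sum (T i i' j)
  nonNeg₁ i i' j = sum-nonNeg (T i i' j) (λ _ → ind-nonNeg _)
  nonNeg₂ : ∀ i i' → 0ℚ ≤ ∑[ j < N ] sum (T i i' j)
  nonNeg₂ i i' = sum-nonNeg _ (nonNeg₁ i i')
  nonNeg₃ : ∀ i → 0ℚ ≤ ∑[ i' < N ] ∑[ j < N ] sum (T i i' j)
  nonNeg₃ i = sum-nonNeg _ (nonNeg₂ i)

collisions-witness : ∀ N s b → ¬ InjOnSupp N s b → 1ℚ ≤ collisions N s b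
collisions-witness N s b ¬inj with 1ℚ ≤? collisions N s b
... | yes 1≤c = 1≤c
... | no  1≰c = ⊥-elim (¬inj injective)
  where
  injective : InjOnSupp N s b
  injective i j i' j' s₁ s₂ ne (e₁ , e₂) =
    <-irrefl collision≡1 (≤-<-trans (collision≤collisions N s b i i' j j') (≰⇒> 1≰c))
    where
    collision≡1 : collision N s b i i' j j' ≡ 1ℚ
    collision≡1 = cong₂ (λ c e → ind (c ∧ e)) (dec-true (collide? N s i j i' j') (ne , e₁ , e₂))
                        (cong₂ _∧_ s₁ s₂)

ind-or-witness : ∀ {A : Set} (a? : Dec A) {S : ℚ} → 0ℚ ≤ S → (¬ A → 1ℚ ≤ S) → 1ℚ ≤ ind (does a?) + S
ind-or-witness (yes _) {S} 0≤S _   = ≤-trans (≤-reflexive (sym (+-identityʳ 1ℚ))) (+-monoʳ-≤ 1ℚ 0≤S)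
ind-or-witness (no ¬a) {S} _   1≤S = ≤-trans (1≤S ¬a) (≤-reflexive (sym (+-identityˡ S)))

ind-mono : ∀ {A B : Set} (a? : Dec A) (b? : Dec B) → (A → B) → ind (does a?) ≤ ind (does b?)
ind-mono (yes a) (yes _) _   = ≤-refl
ind-mono (yes a) (no ¬b) a→b = ⊥-elim (¬b (a→b a))
ind-mono (no _)  b?      _   = ind-nonNeg (does b?)

ind-×-dec : ∀ {A B : Set} (a? : Dec A) (b? : Dec B) →
            ind (does (a? ×-dec b?)) ≡ ind (does a?) * ind (does b?)
ind-×-dec (yes _) (yes _) = sym (*-identityˡ 1ℚ)
ind-×-dec (yes _) (no _)  = sym (*-identityˡ 0ℚ)
ind-×-dec (no _)  b?      = sym (*-zeroˡ (ind (does b?)))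

collide≤congruent : ∀ N s (i j i' j' : Fin N) →
  ind (does (collide? N s i j i' j')) ≤ ind (congruent s i i') * ind (congruent s j j')
collide≤congruent N s i j i' j' =
  ≤-trans (ind-mono (collide? N s i j i' j') (c₁ ×-dec c₂) proj₂) (≤-reflexive (ind-×-dec c₁ c₂))
  where
  c₁ = toℕ i mod s ℕ.≟ toℕ i' mod s
  c₂ = toℕ j mod s ℕ.≟ toℕ j' mod s

combine-injective₂ : ∀ {N} (i j i' j' : Fin N) → combine i j ≡ combine i' j' → (i , j) ≡ (i' , j')
combine-injective₂ i j i' j' eq with FP.combine-injective i j i' j' eq
... | refl , refl = refl

-- A colliding pair consists of two distinct coordinates of b, so it lies in
-- the support with probability p².
Expect-collision : ∀ p N s (i i' j j' : Fin N) →
  Expect p (N ℕ.* N) (λ b → collision N s b i i' j j') ≡ ind (does (collide? N s i j i' j')) * (p * p)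
Expect-collision p N s i i' j j' =
  Expect-guard p (N ℕ.* N) (collide? N s i j i' j') (λ b → supp N b i j ∧ supp N b i' j')
    λ (distinct , _) → Expect-pair p (N ℕ.* N) (combine i j) (combine i' j')
                         (distinct ∘ combine-injective₂ i j i' j')

Expect-collisions : ∀ p N s → Expect p (N ℕ.* N) (collisions N s) ≡
  ∑[ i < N ] ∑[ i' < N ] ∑[ j < N ] ∑[ j' < N ] (ind (does (collide? N s i j i' j')) * (p * p))
Expect-collisions p N s =
  trans (Expect-sum² p d (λ i i' b → ∑[ j < N ] ∑[ j' < N ] collision N s b i i' j j'))
        (sum-cong {N} λ i → sum-cong {N} (row i))
  where
  d = N ℕ.* N
  row : ∀ i i' → Expect p d (λ b → ∑[ j < N ] ∑[ j' < N ] collision N s b i i' j j')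
                 ≡ ∑[ j < N ] ∑[ j' < N ] (ind (does (collide? N s i j i' j')) * (p * p))
  row i i' = trans (Expect-sum² p d (λ j j' b → collision N s b i i' j j'))
                   (sum-cong {N} λ j → sum-cong {N} λ j' → Expect-collision p N s i i' j j')

expected-collisions : ∀ {N} R s .{{_ : NonZero s}} p → R ℕ.* s ≡ N → 0ℚ ≤ p →
  Expect p (N ℕ.* N) (collisions N s) ≤ (fromℕ N * fromℕ R) * ((fromℕ N * fromℕ R) * (p * p))
expected-collisions {N} R s p R*s≡N 0≤p = begin
    Expect p (N ℕ.* N) (collisions N s)
      ≡⟨ Expect-collisions p N s ⟩
    ∑[ i < N ] ∑[ i' < N ] ∑[ j < N ] ∑[ j' < N ] (ind (does (collide? N s i j i' j')) * q)
      ≤⟨ sum-mono {N} (λ i → sum-mono {N} λ i' → sum-mono {N} λ j → sum-mono {N} λ j' →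
           *-monoʳ-≤-nonNeg q {{nonNegative 0≤q}} (collide≤congruent N s i j i' j')) ⟩
    ∑[ i < N ] ∑[ i' < N ] ∑[ j < N ] ∑[ j' < N ] ((C i i' * C j j') * q)
      ≡⟨ ∑⁴-factor C C q ⟩
    P * (P * q)
      ≤⟨ *-mono-≤-nonNeg 0≤P (nonNeg-* (nonNeg-* (fromℕ-nonNeg N) (fromℕ-nonNeg R)) 0≤q) P≤M
           (*-monoʳ-≤-nonNeg q {{nonNegative 0≤q}} P≤M) ⟩
    (fromℕ N * fromℕ R) * ((fromℕ N * fromℕ R) * q) ∎
  where
  open ≤-Reasoning
  q = p * p
  0≤q : 0ℚ ≤ q
  0≤q = nonNeg-* 0≤p 0≤p
  C : Fin N → Fin N → ℚ
  C i i' = ind (congruent s i i')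
  P = ∑[ i < N ] ∑[ i' < N ] C i i'
  0≤P : 0ℚ ≤ P
  0≤P = sum-nonNeg _ λ i → sum-nonNeg (C i) λ i' → ind-nonNeg _
  P≤M : P ≤ fromℕ N * fromℕ R
  P≤M = congruent-pairs R s R*s≡N

fold-injective : ∀ N R s .{{_ : NonZero s}} p → R ℕ.* s ≡ N → 0ℚ ≤ p → p ≤ 1ℚ →
  let M = fromℕ N * fromℕ R in
  1ℚ - (M * p) * (M * p) ≤ Pr p (N ℕ.* N) (λ b → does (injOnSupp? N s b))
fold-injective N R s p R*s≡N 0≤p p≤1 = 1≤x+y⇒1-y≤x _ _ (begin
    1ℚ                                                   ≡⟨ Expect-const p d 1ℚ ⟨
    Expect p d (λ _ → 1ℚ)                                ≤⟨ Expect-mono 0≤p p≤1 d union-bound ⟩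
    Expect p d (λ b → ind (inj b) + collisions N s b)    ≡⟨ Expect-+ p d (ind ∘ inj) (collisions N s) ⟩
    Expect p d (ind ∘ inj) + Expect p d (collisions N s) ≤⟨ +-mono-≤ (≤-reflexive (sym (Pr≡Expect p d inj)))
                                                              (expected-collisions R s p R*s≡N 0≤p) ⟩
    Pr p d inj + M * (M * (p * p))                       ≡⟨ cong (_+_ (Pr p d inj)) (regroup M p) ⟩
    Pr p d inj + (M * p) * (M * p)                       ∎)
  where
  open ≤-Reasoning
  d = N ℕ.* N
  M = fromℕ N * fromℕ R
  inj : (Fin d → Bool) → Bool
  inj b = does (injOnSupp? N s b)
  union-bound : ∀ b → 1ℚ ≤ ind (inj b) + collisions N s b
  union-bound b = ind-or-witness (injOnSupp? N s b) (collisions-nonNeg N s b) (collisions-witness N s b)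
  regroup : ∀ m p → m * (m * (p * p)) ≡ (m * p) * (m * p)
  regroup = solve 2 (λ m p → m :* (m :* (p :* p)) := (m :* p) :* (m :* p)) refl
    where open +-*-Solver

NRp≡a : ∀ N R k a p .{{_ : NonZero N}} → a * fromℕ N ≡ fromℕ (R ℕ.* k) →
        p * fromℕ (N ℕ.* N) ≡ fromℕ k → fromℕ N * fromℕ R * p ≡ a
NRp≡a N R k a p aN≡Rk pN²≡k = cancel (begin
    fromℕ N * fromℕ R * p * fromℕ N      ≡⟨ regroup (fromℕ N) (fromℕ R) p ⟩
    fromℕ R * (p * (fromℕ N * fromℕ N))  ≡⟨ cong (λ x → fromℕ R * (p * x)) (fromℕ-* N N) ⟨
    fromℕ R * (p * fromℕ (N ℕ.* N))      ≡⟨ cong (_*_ (fromℕ R)) pN²≡k ⟩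
    fromℕ R * fromℕ k                    ≡⟨ fromℕ-* R k ⟨
    fromℕ (R ℕ.* k)                      ≡⟨ aN≡Rk ⟨
    a * fromℕ N                          ∎)
  where
  open ≡-Reasoning
  regroup : ∀ n r p → n * r * p * n ≡ r * (p * (n * n))
  regroup = solve 3 (λ n r p → n :* r :* p :* n := r :* (p :* (n :* n))) refl
    where open +-*-Solver
  cancel : ∀ {x y} → x * fromℕ N ≡ y * fromℕ N → x ≡ y
  cancel xN≡yN = ≤-antisym (*-cancelʳ-≤-pos (fromℕ N) {{fromℕ-pos N}} (≤-reflexive xN≡yN))
                           (*-cancelʳ-≤-pos (fromℕ N) {{fromℕ-pos N}} (≤-reflexive (sym xN≡yN)))

fold-injective-a : ∀ N R s k a {{_ : NonZero N}} → R ℕ.* s ≡ N →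
  a * fromℕ N ≡ fromℕ (R ℕ.* k) → a ≤ 1ℚ →
  1ℚ - a * a ≤ Pr (ratio k (N ℕ.* N)) (N ℕ.* N) (λ b → does (injOnSupp? N s b))
fold-injective-a N R s k a {{N≢0}} R*s≡N aN≡Rk a≤1 =
  subst (λ x → 1ℚ - x * x ≤ _) NRp≡a′ (fold-injective N R s p R*s≡N 0≤p p≤1)
  where
  p = ratio k (N ℕ.* N)
  instance
    R*s≢0 : NonZero (R ℕ.* s)
    R*s≢0 = subst NonZero (sym R*s≡N) N≢0
    s≢0 : NonZero s
    s≢0 = ℕP.m*n≢0⇒n≢0 R
    R≢0 : NonZero R
    R≢0 = ℕP.m*n≢0⇒m≢0 R
    N²≢0 : NonZero (N ℕ.* N)
    N²≢0 = ℕP.m*n≢0 N N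
    NR≢0 : NonZero (N ℕ.* R)
    NR≢0 = ℕP.m*n≢0 N R
  0≤p : 0ℚ ≤ p
  0≤p = ratio-nonNeg k (N ℕ.* N)
  NRp≡a′ : fromℕ N * fromℕ R * p ≡ a
  NRp≡a′ = NRp≡a N R k a p aN≡Rk (ratio-*-fromℕ k (N ℕ.* N))
  -- p ≤ N·R·p = a ≤ 1, as N·R ≥ 1
  p≤1 : p ≤ 1ℚ
  p≤1 = begin
    p                     ≡⟨ *-identityˡ p ⟨
    1ℚ * p                ≤⟨ *-monoʳ-≤-nonNeg p {{nonNegative 0≤p}}
                               (subst (1ℚ ≤_) (fromℕ-* N R) (1≤fromℕ (N ℕ.* R))) ⟩
    fromℕ N * fromℕ R * p ≡⟨ NRp≡a′ ⟩
    a                     ≤⟨ a≤1 ⟩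
    1ℚ                    ∎
    where open ≤-Reasoning

square≤self : ∀ {a} → 0ℚ ≤ a → a ≤ 1ℚ → a * a ≤ a
square≤self {a} 0≤a a≤1 =
  ≤-trans (*-monoˡ-≤-nonNeg a {{nonNegative 0≤a}} a≤1) (≤-reflexive (*-identityʳ a))

lemma5 : (α : ℚ) → 0ℚ < α →
    Σ ℚ λ a₀ → 0ℚ < a₀ ×
      ((a : ℚ) → 0ℚ < a → a ≤ a₀ →
       (t R s k : ℕ) →
       R ℕ.* s ≡ 2 ^ t →
       a * ((+ (2 ^ t)) / 1) ≡ (+ (R ℕ.* k)) / 1 →
       1ℚ - α ≤ Pr (ratio k (2 ^ t ℕ.* 2 ^ t)) (2 ^ t ℕ.* 2 ^ t)
                  (λ b → does (injOnSupp? (2 ^ t) s b)))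
lemma5 α 0<α = α ⊓ 1ℚ , 0<a₀ , bound
  where
  0<a₀ : 0ℚ < α ⊓ 1ℚ
  0<a₀ with ⊓-sel α 1ℚ
  ... | inj₁ a₀≡α = subst (0ℚ <_) (sym a₀≡α) 0<α
  ... | inj₂ a₀≡1 = subst (0ℚ <_) (sym a₀≡1) (positive⁻¹ 1ℚ)
  bound : ∀ a → 0ℚ < a → a ≤ α ⊓ 1ℚ → ∀ t R s k → R ℕ.* s ≡ 2 ^ t →
          a * fromℕ (2 ^ t) ≡ fromℕ (R ℕ.* k) →
          1ℚ - α ≤ Pr (ratio k (2 ^ t ℕ.* 2 ^ t)) (2 ^ t ℕ.* 2 ^ t) (λ b → does (injOnSupp? (2 ^ t) s b))
  bound a 0<a a≤a₀ t R s k R*s≡N aN≡Rk =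
    ≤-trans (+-monoʳ-≤ 1ℚ (neg-antimono-≤ a²≤α))
            (fold-injective-a (2 ^ t) R s k a {{ℕP.m^n≢0 2 t}} R*s≡N aN≡Rk a≤1)
    where
    a≤1 : a ≤ 1ℚ
    a≤1 = ≤-trans a≤a₀ (p⊓q≤q α 1ℚ)
    a²≤α : a * a ≤ α
    a²≤α = ≤-trans (square≤self (<⇒≤ 0<a) a≤1) (≤-trans a≤a₀ (p⊓q≤p α 1ℚ))
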